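{- Let $M$ be a simple matroid on a finite ground set $E$ with closure operator $\operatorname{cl}$ and set of circuits $\mathcal{C}$. If $M$ has a minimal tropical basis $\mathcal{C}'$ which contains a circuit $C$ with $\operatorname{cl}(C) \neq C$, then $\mathcal{C}'$ is not the unique minimal tropical basis of $M$, i.e., $M$ has a minimal tropical basis different from $\mathcal{C}'$.
   Context: A subset $\mathcal{C}' \subseteq \mathcal{C}$ is a tropical basis of $M$ if for every $X \subseteq E$ with $X \neq \operatorname{cl}(X)$ there exists $C \in \mathcal{C}'$ with $|C \setminus X| = 1$. A tropical basis $\mathcal{C}'$ is minimal if for every $C \in \mathcal{C}'$ the family $\mathcal{C}' \setminus \{C\}$ is not a tropical basis. -}

module Defs where

open import Data.Nat using (ℕ; _≤_)
open import Data.Bool using (Bool; true; false; if_then_else_)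
import Data.Bool as Bool
open import Data.Vec.Properties using (≡-dec)
open import Relation.Nullary using (¬_; does)
open import Data.Fin using (Fin)
open import Data.Fin.Subset using (Subset; _∈_; _∉_; _⊆_; _∪_; _─_; _-_; ∣_∣; ⊥)
open import Data.Product using (Σ; _×_; ∃; ∃-syntax)
open import Data.Sum using (_⊎_)
open import Relation.Binary.PropositionalEquality using (_≡_; _≢_)

Family : ℕ → Set
Family n = Subset n → Bool

record Matroid (n : ℕ) : Set where
  field
    circuit : Family n
    C1 : circuit ⊥ ≡ false
    C2 : ∀ C D → circuit C ≡ true → circuit D ≡ true → C ⊆ D → C ≡ D
    C3 : ∀ C D (e : Fin n) → circuit C ≡ true → circuit D ≡ true → C ≢ D →
         e ∈ C → e ∈ D →
         ∃[ F ] (circuit F ≡ true × F ⊆ ((C ∪ D) - e))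
open Matroid public

InCl : ∀ {n} → Matroid n → Subset n → Fin n → Set
InCl M X e = e ∈ X ⊎ ∃[ C ] (circuit M C ≡ true × e ∈ C × (C - e) ⊆ X)

-- X ≠ cl(X)  (since X ⊆ cl(X) always, this says some e ∈ cl(X) is not in X)
NotClosed : ∀ {n} → Matroid n → Subset n → Set
NotClosed M X = ∃[ e ] (InCl M X e × e ∉ X)

-- simple: no loops and no parallel elements, i.e. every circuit has ≥ 3 elements
Simple : ∀ {n} → Matroid n → Set
Simple M = ∀ C → circuit M C ≡ true → 3 ≤ ∣ C ∣

SubFamily : ∀ {n} → Family n → Family n → Set
SubFamily F G = ∀ C → F C ≡ true → G C ≡ true

IsTropicalBasis : ∀ {n} → Matroid n → Family n → Set
IsTropicalBasis M F =
  SubFamily F (circuit M) ×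
  (∀ X → NotClosed M X → ∃[ C ] (F C ≡ true × ∣ C ─ X ∣ ≡ 1))

remove : ∀ {n} → Family n → Subset n → Family n
remove F C D = if does (≡-dec Bool._≟_ D C) then false else F D

IsMinimalTropicalBasis : ∀ {n} → Matroid n → Family n → Set
IsMinimalTropicalBasis M F =
  IsTropicalBasis M F × (∀ C → F C ≡ true → ¬ IsTropicalBasis M (remove F C))

{-# OPTIONS --safe #-}
-- Let D be a circuit witnessing f ∈ cl(C) ∖ C, so that D ⊆ C ∪ {f}.  Whenever C is the
-- circuit showing that X is not closed (C ∖ X = {e}), some other circuit also has exactly
-- one element outside X: D itself, or a circuit obtained by eliminating e, or an element
-- g ∈ C ∩ D (which exists as f is not a loop), between C and D.  In the last case e lies in
-- the new circuit F, for otherwise eliminating f between D and F would give a circuit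
-- strictly inside C.  So the circuits other than C form a tropical basis; pruning it gives
-- a minimal tropical basis without C, whereas C ∈ C'.
module Submission where

open import Defs
open import Data.Nat using (ℕ; zero; suc; _≤_; s≤s)
import Data.Nat as ℕ
open import Data.Nat.Properties using (≤-trans; n≤1+n)
open import Data.Bool using (true; false)
open import Data.Bool.Properties using (not-¬; ¬-not)
import Data.Bool as Bool
open import Data.Vec using ([]; _∷_; here; there)
open import Data.Vec.Properties using (≡-dec)
open import Data.Fin using (Fin)
open import Data.Fin.Properties using (any?) renaming (_≟_ to _≟ᶠ_)
open import Data.Fin.Subset
  using (Subset; inside; outside; _∈_; _∉_; _⊆_; _⊄_; _∪_; _─_; _-_; ∣_∣; ⁅_⁆)
open import Data.Fin.Subset.Properties
  using (_∈?_; _⊆?_; anySubset?; x∈⁅x⁆; x∈⁅y⁆⇒x≡y; x∉⁅y⁆⇒x≢y; ∣⁅x⁆∣≡1; ⊆-antisym;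
         p⊆q⇒∣p∣≤∣q∣; p─q⊆p; x∈p∧x∉q⇒x∈p─q; x∈p∧x≢y⇒x∈p-y; x∈p∪q⁻; x∈p∪q⁺)
open import Data.List using (List; []; _∷_; [_]; map; _++_)
open import Data.List.Membership.Propositional using () renaming (_∈_ to _∈ˡ_)
open import Data.List.Membership.Propositional.Properties using (∈-map⁺; ∈-++⁺ˡ; ∈-++⁺ʳ)
open import Data.List.Relation.Unary.Any using () renaming (here to hereˡ; there to thereˡ)
open import Data.Product using (_×_; _,_; proj₂; ∃-syntax)
open import Data.Sum using (_⊎_; inj₁; inj₂; [_,_]′; fromInj₂)
open import Function using (_∘_)
open import Data.Empty using (⊥-elim)
open import Relation.Nullary using (¬_; Dec; yes; no)
open import Relation.Nullary.Decidable using (_×-dec_; _⊎-dec_; _→-dec_; ¬?; decidable-stable)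
open import Relation.Binary.PropositionalEquality using (_≡_; _≢_; refl; sym; trans; cong; subst)

x∈p─q⇒x∉q : ∀ {n} {x : Fin n} (p q : Subset n) → x ∈ p ─ q → x ∉ q
x∈p─q⇒x∉q (inside ∷ p) (outside ∷ q) here ()
x∈p─q⇒x∉q (_ ∷ p) (_ ∷ q) (there x∈p─q) (there x∈q) = x∈p─q⇒x∉q p q x∈p─q x∈q

2≤∣p∣⇒∃≢ : ∀ {n} (p : Subset n) (x : Fin n) → 2 ≤ ∣ p ∣ → ∃[ y ] (y ∈ p × y ≢ x)
2≤∣p∣⇒∃≢ p x 2≤∣p∣ with any? (λ y → (y ∈? p) ×-dec ¬? (y ≟ᶠ x))
... | yes y = y
... | no ∄y = ⊥-elim (one≱two (≤-trans 2≤∣p∣ (subst (∣ p ∣ ≤_) (∣⁅x⁆∣≡1 x) (p⊆q⇒∣p∣≤∣q∣ p⊆⁅x⁆))))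
  where
  p⊆⁅x⁆ : p ⊆ ⁅ x ⁆
  p⊆⁅x⁆ {y} y∈p with y ≟ᶠ x
  ... | yes refl = x∈⁅x⁆ x
  ... | no y≢x   = ⊥-elim (∄y (y , y∈p , y≢x))
  one≱two : ¬ (2 ≤ 1)
  one≱two (s≤s ())

x∈p∪⁅y⁆∧x≢y⇒x∈p : ∀ {n} {x y : Fin n} (p : Subset n) → x ∈ p ∪ ⁅ y ⁆ → x ≢ y → x ∈ p
x∈p∪⁅y⁆∧x≢y⇒x∈p {y = y} p x∈p∪⁅y⁆ x≢y with x∈p∪q⁻ p ⁅ y ⁆ x∈p∪⁅y⁆
... | inj₁ x∈p   = x∈p
... | inj₂ x∈⁅y⁆ = ⊥-elim (x≢y (x∈⁅y⁆⇒x≡y y x∈⁅y⁆))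

OnlyOutside : ∀ {n} → Subset n → Subset n → Fin n → Set
OnlyOutside W X w = w ∈ W × w ∉ X × (∀ {y} → y ∈ W → y ≢ w → y ∈ X)

OnlyOutside⇒∣─∣≡1 : ∀ {n} {W X : Subset n} {w} → OnlyOutside W X w → ∣ W ─ X ∣ ≡ 1
OnlyOutside⇒∣─∣≡1 {W = W} {X} {w} (w∈W , w∉X , rest) =
  trans (cong ∣_∣ (⊆-antisym W─X⊆⁅w⁆ ⁅w⁆⊆W─X)) (∣⁅x⁆∣≡1 w)
  where
  W─X⊆⁅w⁆ : W ─ X ⊆ ⁅ w ⁆
  W─X⊆⁅w⁆ {y} y∈W─X with y ≟ᶠ w
  ... | yes refl = x∈⁅x⁆ w
  ... | no  y≢w  = ⊥-elim (x∈p─q⇒x∉q W X y∈W─X (rest (p─q⊆p W X y∈W─X) y≢w))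
  ⁅w⁆⊆W─X : ⁅ w ⁆ ⊆ W ─ X
  ⁅w⁆⊆W─X y∈⁅w⁆ with x∈⁅y⁆⇒x≡y w y∈⁅w⁆
  ... | refl = x∈p∧x∉q⇒x∈p─q w∈W w∉X

module _ {n} (M : Matroid n) where

  IsCircuit : Subset n → Set
  IsCircuit C = circuit M C ≡ true

  circuit-⊄ : ∀ {F C} → IsCircuit F → IsCircuit C → F ⊄ C
  circuit-⊄ cF cC (F⊆C , x , x∈C , x∉F) with C2 M _ _ cF cC F⊆C
  ... | refl = x∉F x∈C

  eliminate : ∀ {V W x} → IsCircuit V → IsCircuit W → V ≢ W → x ∈ V → x ∈ W →
              ∃[ F ] (IsCircuit F × x ∉ F × (∀ {y} → y ∈ F → y ∈ V ⊎ y ∈ W))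
  eliminate {V} {W} {x} cV cW V≢W x∈V x∈W with C3 M V W x cV cW V≢W x∈V x∈W
  ... | F , cF , F⊆V∪W-x = F , cF , x∉F ,
    λ y∈F → x∈p∪q⁻ V W (p─q⊆p (V ∪ W) ⁅ x ⁆ (F⊆V∪W-x y∈F))
    where
    x∉F : x ∉ F
    x∉F x∈F = x∉⁅y⁆⇒x≢y (x∈p─q⇒x∉q (V ∪ W) ⁅ x ⁆ (F⊆V∪W-x x∈F)) refl

  NotClosed⇒OnlyOutside : ∀ {X} → NotClosed M X → ∃[ W ] (IsCircuit W × ∃[ w ] OnlyOutside W X w)
  NotClosed⇒OnlyOutside (w , inj₁ w∈X , w∉X) = ⊥-elim (w∉X w∈X)
  NotClosed⇒OnlyOutside (w , inj₂ (W , cW , w∈W , W-w⊆X) , w∉X) =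
    W , cW , w , w∈W , w∉X , λ y∈W y≢w → W-w⊆X (x∈p∧x≢y⇒x∈p-y y∈W y≢w)

module _ {n} (M : Matroid n) {C D : Subset n} {f : Fin n}
         (cC : IsCircuit M C) (cD : IsCircuit M D)
         (f∈D : f ∈ D) (f∉C : f ∉ C) (D-f⊆C : ∀ {y} → y ∈ D → y ≢ f → y ∈ C) where

  D⊆C∪⁅f⁆ : D ⊆ C ∪ ⁅ f ⁆
  D⊆C∪⁅f⁆ {y} y∈D with y ≟ᶠ f
  ... | yes refl = x∈p∪q⁺ (inj₂ (x∈⁅x⁆ f))
  ... | no  y≢f  = x∈p∪q⁺ (inj₁ (D-f⊆C y∈D y≢f))

  f∈W≢C : ∀ {W} → f ∈ W → W ≢ C
  f∈W≢C f∈W refl = f∉C f∈W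

  ⊆C∪⁅f⁆-circuit-∋f : ∀ {W x} → IsCircuit M W → W ⊆ C ∪ ⁅ f ⁆ → x ∈ C → x ∉ W → f ∈ W
  ⊆C∪⁅f⁆-circuit-∋f {W} {x} cW W⊆C∪⁅f⁆ x∈C x∉W with f ∈? W
  ... | yes f∈W = f∈W
  ... | no  f∉W = ⊥-elim (circuit-⊄ M cW cC (W⊆C , x , x∈C , x∉W))
    where
    W⊆C : W ⊆ C
    W⊆C {y} y∈W = x∈p∪⁅y⁆∧x≢y⇒x∈p C (W⊆C∪⁅f⁆ y∈W) λ { refl → f∉W y∈W }

  eliminate-C-D : ∀ {x} → x ∈ C → x ∈ D → ∃[ F ] (IsCircuit M F × x ∉ F × F ⊆ C ∪ ⁅ f ⁆)
  eliminate-C-D x∈C x∈D with eliminate M cC cD (f∈W≢C f∈D ∘ sym) x∈C x∈D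
  ... | F , cF , x∉F , F⊆C∪D = F , cF , x∉F , λ y∈F → [ x∈p∪q⁺ ∘ inj₁ , D⊆C∪⁅f⁆ ]′ (F⊆C∪D y∈F)

  circuits-∋f-in-C∪⁅f⁆-cover-C : ∀ {V W e} → IsCircuit M V → IsCircuit M W → V ≢ W →
    f ∈ V → f ∈ W → V ⊆ C ∪ ⁅ f ⁆ → W ⊆ C ∪ ⁅ f ⁆ → e ∈ C → e ∈ V ⊎ e ∈ W
  circuits-∋f-in-C∪⁅f⁆-cover-C {V} {W} {e} cV cW V≢W f∈V f∈W V⊆C∪⁅f⁆ W⊆C∪⁅f⁆ e∈C
    with eliminate M cV cW V≢W f∈V f∈W
  ... | G , cG , f∉G , G⊆V∪W with e ∈? G
  ...   | yes e∈G = G⊆V∪W e∈G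
  ...   | no  e∉G = ⊥-elim (circuit-⊄ M cG cC (G⊆C , e , e∈C , e∉G))
    where
    G⊆C : G ⊆ C
    G⊆C y∈G = x∈p∪⁅y⁆∧x≢y⇒x∈p C ([ V⊆C∪⁅f⁆ , W⊆C∪⁅f⁆ ]′ (G⊆V∪W y∈G)) λ { refl → f∉G y∈G }

  C-meets-D : 2 ≤ ∣ D ∣ → ∃[ g ] (g ∈ C × g ∈ D)
  C-meets-D 2≤∣D∣ with 2≤∣p∣⇒∃≢ D f 2≤∣D∣
  ... | g , g∈D , g≢f = g , x∈p∪⁅y⁆∧x≢y⇒x∈p C (D⊆C∪⁅f⁆ g∈D) g≢f , g∈D

  circuit-∋e-≢C : ∀ {e} → e ∈ C → e ∉ D → 2 ≤ ∣ D ∣ →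
                          ∃[ F ] (IsCircuit M F × F ≢ C × e ∈ F × F ⊆ C ∪ ⁅ f ⁆)
  circuit-∋e-≢C {e} e∈C e∉D 2≤∣D∣ with C-meets-D 2≤∣D∣
  ... | g , g∈C , g∈D with eliminate-C-D g∈C g∈D
  ...   | F , cF , g∉F , F⊆C∪⁅f⁆ = F , cF , F≢C , fromInj₂ (⊥-elim ∘ e∉D) e∈D⊎e∈F , F⊆C∪⁅f⁆
    where
    F≢C : F ≢ C
    F≢C refl = g∉F g∈C
    e∈D⊎e∈F : e ∈ D ⊎ e ∈ F
    e∈D⊎e∈F = circuits-∋f-in-C∪⁅f⁆-cover-C cD cF (λ { refl → g∉F g∈D }) f∈D
                (⊆C∪⁅f⁆-circuit-∋f cF F⊆C∪⁅f⁆ g∈C g∉F) D⊆C∪⁅f⁆ F⊆C∪⁅f⁆ e∈C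

  only-e-outside : ∀ {X e W} → OnlyOutside C X e → f ∈ X → W ⊆ C ∪ ⁅ f ⁆ → e ∈ W → OnlyOutside W X e
  only-e-outside {X} {e} (_ , e∉X , C-e⊆X) f∈X W⊆C∪⁅f⁆ e∈W =
    e∈W , e∉X , λ y∈W y≢e → y∈X (W⊆C∪⁅f⁆ y∈W) y≢e
    where
    y∈X : ∀ {y} → y ∈ C ∪ ⁅ f ⁆ → y ≢ e → y ∈ X
    y∈X {y} y∈C∪⁅f⁆ y≢e with x∈p∪q⁻ C ⁅ f ⁆ y∈C∪⁅f⁆
    ... | inj₁ y∈C   = C-e⊆X y∈C y≢e
    ... | inj₂ y∈⁅f⁆ = subst (_∈ X) (sym (x∈⁅y⁆⇒x≡y f y∈⁅f⁆)) f∈X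

  only-f-outside : ∀ {X e W} → OnlyOutside C X e → f ∉ X → W ⊆ C ∪ ⁅ f ⁆ → f ∈ W → e ∉ W →
                   OnlyOutside W X f
  only-f-outside (_ , _ , C-e⊆X) f∉X W⊆C∪⁅f⁆ f∈W e∉W = f∈W , f∉X , λ y∈W y≢f →
    C-e⊆X (x∈p∪⁅y⁆∧x≢y⇒x∈p C (W⊆C∪⁅f⁆ y∈W) y≢f) λ { refl → e∉W y∈W }

  -- D ∖ X ⊆ {e, f}, so D itself works when exactly one of e ∈ D and f ∉ X holds.
  another-circuit-OnlyOutside : ∀ {X e} → 2 ≤ ∣ D ∣ → OnlyOutside C X e →
                                ∃[ W ] (IsCircuit M W × W ≢ C × ∃[ w ] OnlyOutside W X w)
  another-circuit-OnlyOutside {X} {e} 2≤∣D∣ C-only-e@(e∈C , _) with f ∈? X | e ∈? D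
  ... | yes f∈X | yes e∈D = D , cD , f∈W≢C f∈D , e , only-e-outside C-only-e f∈X D⊆C∪⁅f⁆ e∈D
  ... | no  f∉X | no  e∉D = D , cD , f∈W≢C f∈D , f , only-f-outside C-only-e f∉X D⊆C∪⁅f⁆ f∈D e∉D
  ... | yes f∈X | no  e∉D with circuit-∋e-≢C e∈C e∉D 2≤∣D∣
  ...   | F , cF , F≢C , e∈F , F⊆C∪⁅f⁆ = F , cF , F≢C , e , only-e-outside C-only-e f∈X F⊆C∪⁅f⁆ e∈F
  another-circuit-OnlyOutside 2≤∣D∣ C-only-e@(e∈C , _) | no f∉X | yes e∈D with eliminate-C-D e∈C e∈D
  ...   | F , cF , e∉F , F⊆C∪⁅f⁆ = F , cF , f∈W≢C f∈F , f , only-f-outside C-only-e f∉X F⊆C∪⁅f⁆ f∈F e∉F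
    where
    f∈F : f ∈ F
    f∈F = ⊆C∪⁅f⁆-circuit-∋f cF F⊆C∪⁅f⁆ e∈C e∉F

Covers : ∀ {n} → Matroid n → Family n → Set
Covers M F = ∀ X → NotClosed M X → ∃[ C ] (F C ≡ true × ∣ C ─ X ∣ ≡ 1)

remove-self : ∀ {n} (F : Family n) C → remove F C C ≡ false
remove-self F C with ≡-dec Bool._≟_ C C
... | yes _   = refl
... | no  C≢C = ⊥-elim (C≢C refl)

remove-other : ∀ {n} (F : Family n) {C D} → D ≢ C → remove F C D ≡ F D
remove-other F {C} {D} D≢C with ≡-dec Bool._≟_ D C
... | yes D≡C = ⊥-elim (D≢C D≡C)
... | no  _   = refl

remove-⊆ : ∀ {n} (F : Family n) C → SubFamily (remove F C) F
remove-⊆ F C D FD with ≡-dec Bool._≟_ D C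
... | no _ = FD

remove-mono : ∀ {n} {F G : Family n} C → SubFamily F G → SubFamily (remove F C) (remove G C)
remove-mono C F⊆G D FD with ≡-dec Bool._≟_ D C
... | no _ = F⊆G D FD

Covers-mono : ∀ {n} (M : Matroid n) {F G : Family n} → SubFamily F G → Covers M F → Covers M G
Covers-mono M F⊆G F-covers X X-open with F-covers X X-open
... | C , FC , ∣C─X∣≡1 = C , F⊆G C FC , ∣C─X∣≡1

allSubset? : ∀ {n} {P : Subset n → Set} → (∀ p → Dec (P p)) → Dec (∀ p → P p)
allSubset? P? with anySubset? (¬? ∘ P?)
... | yes (p , ¬Pp) = no λ ∀P → ¬Pp (∀P p)
... | no  ∄¬P       = yes λ p → decidable-stable (P? p) λ ¬Pp → ∄¬P (p , ¬Pp)

InCl? : ∀ {n} (M : Matroid n) X e → Dec (InCl M X e)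
InCl? M X e = (e ∈? X) ⊎-dec anySubset? λ C → (circuit M C Bool.≟ true) ×-dec (e ∈? C) ×-dec (C - e ⊆? X)

NotClosed? : ∀ {n} (M : Matroid n) X → Dec (NotClosed M X)
NotClosed? M X = any? λ e → InCl? M X e ×-dec ¬? (e ∈? X)

Covers? : ∀ {n} (M : Matroid n) F → Dec (Covers M F)
Covers? M F = allSubset? λ X →
  NotClosed? M X →-dec anySubset? λ C → (F C Bool.≟ true) ×-dec (∣ C ─ X ∣ ℕ.≟ 1)

Loopless : ∀ {n} → Matroid n → Set
Loopless M = ∀ C → IsCircuit M C → 2 ≤ ∣ C ∣

Simple⇒Loopless : ∀ {n} (M : Matroid n) → Simple M → Loopless M
Simple⇒Loopless M simple C cC = ≤-trans (n≤1+n 2) (simple C cC)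

remove-nonclosed-circuit-Covers : ∀ {n} (M : Matroid n) → Loopless M → ∀ {C} → IsCircuit M C →
                                  NotClosed M C → Covers M (remove (circuit M) C)
remove-nonclosed-circuit-Covers M loopless {C} cC C-open X X-open
  with NotClosed⇒OnlyOutside M C-open | NotClosed⇒OnlyOutside M X-open
... | D , cD , f , f∈D , f∉C , D-f⊆C | W , cW , e , W-only-e with ≡-dec Bool._≟_ W C
...   | no  W≢C = W , trans (remove-other (circuit M) W≢C) cW , OnlyOutside⇒∣─∣≡1 W-only-e
...   | yes refl with another-circuit-OnlyOutside M cC cD f∈D f∉C D-f⊆C (loopless D cD) W-only-e
...     | V , cV , V≢C , v , V-only-v = V , trans (remove-other (circuit M) V≢C) cV , OnlyOutside⇒∣─∣≡1 V-only-v

subsets : ∀ n → List (Subset n)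
subsets zero    = [ [] ]
subsets (suc n) = map (inside ∷_) (subsets n) ++ map (outside ∷_) (subsets n)

∈-subsets : ∀ {n} (p : Subset n) → p ∈ˡ subsets n
∈-subsets []            = hereˡ refl
∈-subsets (inside ∷ p)  = ∈-++⁺ˡ (∈-map⁺ (inside ∷_) (∈-subsets p))
∈-subsets (outside ∷ p) = ∈-++⁺ʳ (map (inside ∷_) (subsets _)) (∈-map⁺ (outside ∷_) (∈-subsets p))

module _ {n} (P : Family n → Set) (P? : ∀ F → Dec (P F))
         (P-mono : ∀ {F G} → SubFamily F G → P F → P G) where

  prune : ∀ {F} (L : List (Subset n)) → P F →
          ∃[ G ] (P G × SubFamily G F × (∀ {S} → S ∈ˡ L → G S ≡ true → ¬ P (remove G S)))
  prune []           PF = _ , PF , (λ _ FS → FS) , λ ()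
  prune {F} (S ∷ L) PF with P? (remove F S)
  ... | yes PF-S with prune L PF-S
  ...   | G , PG , G⊆F-S , G-min = G , PG , (λ T → remove-⊆ F S T ∘ G⊆F-S T) , λ where
    (hereˡ refl) GS _ → not-¬ (remove-self F S) (G⊆F-S S GS)
    (thereˡ S∈L)      → G-min S∈L
  prune {F} (S ∷ L) PF | no ¬PF-S with prune L PF
  ...   | G , PG , G⊆F , G-min = G , PG , G⊆F , λ where
    (hereˡ refl) _ PG-S → ¬PF-S (P-mono (remove-mono S G⊆F) PG-S)
    (thereˡ S∈L)        → G-min S∈L

  minimal-subfamily : ∀ {F} → P F → ∃[ G ] (P G × SubFamily G F × (∀ S → G S ≡ true → ¬ P (remove G S)))
  minimal-subfamily PF with prune (subsets n) PF
  ... | G , PG , G⊆F , G-min = G , PG , G⊆F , λ S → G-min (∈-subsets S)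

minimal-tropical-basis-avoiding : ∀ {n} (M : Matroid n) → Loopless M → ∀ {C} → IsCircuit M C →
  NotClosed M C → ∃[ B ] (IsMinimalTropicalBasis M B × B C ≡ false)
minimal-tropical-basis-avoiding M loopless {C} cC C-open
  with minimal-subfamily (Covers M) (Covers? M) (Covers-mono M)
         (remove-nonclosed-circuit-Covers M loopless cC C-open)
... | B , B-covers , B⊆circuits-C , B-min =
  B , (((λ S → remove-⊆ (circuit M) C S ∘ B⊆circuits-C S) , B-covers) , (λ S BS → B-min S BS ∘ proj₂)) ,
  ¬-not (not-¬ (remove-self (circuit M) C) ∘ B⊆circuits-C C)

theorem3 : (n : ℕ) (M : Matroid n) → Simple M →
    (C' : Family n) → IsMinimalTropicalBasis M C' →
    (C : Subset n) → C' C ≡ true → NotClosed M C →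
    ∃[ C'' ] (IsMinimalTropicalBasis M C'' × ∃[ D ] (C'' D ≢ C' D))
theorem3 n M simple C' ((C'⊆circuits , _) , _) C C'C C-open
  with minimal-tropical-basis-avoiding M (Simple⇒Loopless M simple) (C'⊆circuits C C'C) C-open
... | B , B-minimal , BC = B , B-minimal , C , λ BC≡C'C → not-¬ BC (trans BC≡C'C C'C)
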